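{- Let $G=(V,E)$ be a primitive strongly regular graph with parameters $(v,k,\lambda,\mu)$, and let $k>\theta_1>\theta_2$ be the distinct eigenvalues of its $(0,1)$ adjacency matrix. Let $H$ be a subset of $V$ of cardinality $h$, and let $S(G,H)$ be the graph obtained from $G$ by switching with respect to $H$. Suppose $v=2(k-\theta_1)$. Then the following are equivalent: (i) $S(G,H)$ is a strongly regular graph with parameters $(v,k,\lambda,\mu)$; (ii) the subgraph of $G$ induced by $H$ is $\left(k-\frac{v-h}{2}\right)$-regular.
   Context: A simple graph is strongly regular with parameters $(v,k,\lambda,\mu)$ if it has $v$ vertices, is $k$-regular, any two adjacent vertices have exactly $\lambda$ common neighbours, and any two distinct nonadjacent vertices have exactly $\mu$ common neighbours. It is primitive if both it and its complement are connected. The $(0,1)$ adjacency matrix has $(x,y)$ entry $1$ if $x,y$ are adjacent and $0$ otherwise. For $H\subseteq V$, the switched graph $S(G,H)$ has vertex set $V$; for $x,y$ both in $H$ or both in $V\setminus H$ adjacency is as in $G$, while for $x\in H$, $y\in V\setminus H$ the pair $x,y$ is adjacent in $S(G,H)$ if and only if it is not adjacent in $G$. -}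

module Defs where

open import Data.Nat using (ℕ; zero; suc)
open import Data.Bool using (Bool; true; false; not; _∧_; _xor_; if_then_else_)
open import Data.Fin using (Fin; zero; suc; _≟_)
open import Data.Integer using (ℤ; 0ℤ; 1ℤ) renaming (_+_ to _+ℤ_; _*_ to _*ℤ_)
open import Data.Product using (Σ; _×_)
open import Relation.Nullary using (¬_)
open import Relation.Nullary.Decidable using (⌊_⌋)
open import Relation.Binary.PropositionalEquality using (_≡_; _≢_; refl; cong; cong₂; trans) renaming (sym to ≡-sym)
open import Relation.Nullary using (yes; no)
open import Data.Empty using (⊥-elim)
open import Data.Bool.Properties using (∧-zeroʳ; xor-comm; xor-same)

record Graph (n : ℕ) : Set where
  field
    adj   : Fin n → Fin n → Bool
    adj-sym : ∀ x y → adj x y ≡ adj y x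
    loopless : ∀ x → adj x x ≡ false
open Graph public

count : {n : ℕ} → (Fin n → Bool) → ℕ
count {zero}  p = 0
count {suc n} p = (if p zero then 1 else 0) Data.Nat.+ count (λ i → p (suc i))

sumℤ : {n : ℕ} → (Fin n → ℤ) → ℤ
sumℤ {zero}  f = 0ℤ
sumℤ {suc n} f = f zero +ℤ sumℤ (λ i → f (suc i))

degree : {n : ℕ} → Graph n → Fin n → ℕ
degree G x = count (adj G x)

commonNbrs : {n : ℕ} → Graph n → Fin n → Fin n → ℕ
commonNbrs G x y = count (λ z → adj G x z ∧ adj G y z)

IsSRG : {n : ℕ} → Graph n → ℕ → ℕ → ℕ → Set
IsSRG G k lam mu =
  (∀ x → degree G x ≡ k) ×
  (∀ x y → x ≢ y → adj G x y ≡ true  → commonNbrs G x y ≡ lam) ×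
  (∀ x y → x ≢ y → adj G x y ≡ false → commonNbrs G x y ≡ mu)

data Reach {n : ℕ} (G : Graph n) : Fin n → Fin n → Set where
  here : ∀ {x} → Reach G x x
  step : ∀ {x y z} → adj G x y ≡ true → Reach G y z → Reach G x z

Connected : {n : ℕ} → Graph n → Set
Connected G = ∀ x y → Reach G x y

eqᵇ : {n : ℕ} → Fin n → Fin n → Bool
eqᵇ x y = ⌊ x ≟ y ⌋

eqᵇ-sym : {n : ℕ} (x y : Fin n) → eqᵇ x y ≡ eqᵇ y x
eqᵇ-sym x y with x ≟ y | y ≟ x
... | yes _ | yes _ = refl
... | yes p | no q = ⊥-elim (q (≡-sym p))
... | no p | yes q = ⊥-elim (p (≡-sym q))
... | no _ | no _ = refl

eqᵇ-refl : {n : ℕ} (x : Fin n) → eqᵇ x x ≡ true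
eqᵇ-refl x with x ≟ x
... | yes _ = refl
... | no p = ⊥-elim (p refl)

complement : {n : ℕ} → Graph n → Graph n
complement G = record
  { adj = λ x y → not (adj G x y) ∧ not (eqᵇ x y)
  ; adj-sym = λ x y → cong₂ (λ a b → not a ∧ not b) (adj-sym G x y) (eqᵇ-sym x y)
  ; loopless = λ x → trans (cong (λ b → not (adj G x x) ∧ not b) (eqᵇ-refl x)) (∧-zeroʳ _) }

Primitive : {n : ℕ} → Graph n → Set
Primitive G = Connected G × Connected (complement G)

adjMat : {n : ℕ} → Graph n → Fin n → Fin n → ℤ
adjMat G x y = if adj G x y then 1ℤ else 0ℤ

IsEigenvalue : {n : ℕ} → Graph n → ℤ → Set
IsEigenvalue {n} G θ =
  Σ (Fin n → ℤ) λ u →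
    (¬ (∀ x → u x ≡ 0ℤ)) ×
    (∀ x → sumℤ (λ y → adjMat G x y *ℤ u y) ≡ θ *ℤ u x)

switch : {n : ℕ} → Graph n → (Fin n → Bool) → Graph n
switch G H = record
  { adj = λ x y → adj G x y xor (H x xor H y)
  ; adj-sym = symS
  ; loopless = loopS }
  where
  symS : ∀ x y → (adj G x y xor (H x xor H y)) ≡ (adj G y x xor (H y xor H x))
  symS x y = cong₂ _xor_ (adj-sym G x y) (xor-comm (H x) (H y))
  loopS : ∀ x → (adj G x x xor (H x xor H x)) ≡ false
  loopS x rewrite Graph.loopless G x | xor-same (H x) = Relation.Binary.PropositionalEquality.refl

inducedDegree : {n : ℕ} → Graph n → (Fin n → Bool) → Fin n → ℕ
inducedDegree G H x = count (λ y → H y ∧ adj G x y)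

module Submission where

-- Write σ(b) = 1 − 2ι(b) for the sign of a Boolean.  Switching with respect to H multiplies the
-- sign of the pair {x, y} by σ(H x)σ(H y).  Signed walk counts Σ_z σ(x~z)σ(z~y) encode degrees and
-- common neighbours, so switching transforms them by the same factor.  Two facts carry the proof.
--   • Once v + 2λ + 2μ = 4k, the λ/μ conditions of a k-regular graph say exactly that the signed walk
--     count of x ≠ y is 2(μ − λ)σ(x~y); this "walk condition" is invariant under switching.  The
--     relation itself follows from v = 2(k − θ₁): θ₁ is a root of x² = (λ − μ)x + (k − μ), and the
--     vertex count k² = (k − μ) + (λ − μ)k + μv then forces θ₁ = λ + μ − k.
--   • Switching preserves the degree of x iff x has a balanced number of H-neighbours: k − (v − h)/2
--     for x ∈ H, h/2 for x ∉ H.  Balance on H propagates off H: F = v·𝟙_H − h·𝟙 ⊥ 𝟙 satisfies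
--     AF = θ₁F on H and is constant off H, and a positivity argument on g = AF − θ₁F (which is an
--     eigenvector for the other root and orthogonal to F) shows g = 0.

open import Defs
open import Data.Nat as ℕ using (ℕ; zero; suc)
open import Data.Bool using (Bool; true; false; _∧_; _xor_; if_then_else_)
open import Data.Bool.Properties using (if-float)
open import Data.Fin using (Fin; zero; suc) renaming (_≟_ to _≟ᶠ_)
open import Data.Integer using (ℤ; +_; -[1+_]; _+_; _-_; _*_; -_; 0ℤ; 1ℤ; _<_; ≢-nonZero)
open import Data.Integer.Properties
  using ( +-*-semiring; +-identityˡ; +-identityʳ; +-inverseʳ; +-injective; *-zeroʳ; *-identityˡ
        ; *-identityʳ; *-assoc; *-comm; *-cancelˡ-≡; pos-*; i-j≡0⇒i≡j; i≡j⇒i-j≡0; i*j≡0⇒i≡0∨j≡0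
        ; <⇒≢; _≟_ )
open import Data.Integer.Tactic.RingSolver using (solve; solve-∀)
open import Data.List using (_∷_; [])
open import Data.Product using (_×_; _,_; proj₁; proj₂; Σ-syntax)
open import Data.Sum using (_⊎_; inj₁; inj₂; [_,_]′)
open import Data.Empty using (⊥-elim)
open import Function using (id)
open import Function.Bundles using (_⇔_; mk⇔; Equivalence)
open import Function.Construct.Composition using (_⇔-∘_)
open import Relation.Nullary using (yes; no)
open import Relation.Binary.PropositionalEquality
open ≡-Reasoning
open import Algebra.Properties.Semiring.Sum +-*-semiring
  using (sum; sum-cong-≗; ∑-distrib-+; ∑-comm; *-distribˡ-sum; *-distribʳ-sum)

private variable n : ℕ

ι : Bool → ℤ
ι b = if b then 1ℤ else 0ℤ

ι-∧ : ∀ a b → ι (a ∧ b) ≡ ι a * ι b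
ι-∧ true  b = sym (*-identityˡ (ι b))
ι-∧ false b = refl

ι-idem : ∀ b → ι b * ι b ≡ ι b
ι-idem true  = refl
ι-idem false = refl

sumℤ≡sum : (f : Fin n → ℤ) → sumℤ f ≡ sum f
sumℤ≡sum {zero}  f = refl
sumℤ≡sum {suc n} f = cong (_+_ (f zero)) (sumℤ≡sum (λ i → f (suc i)))

count≡sum : (p : Fin n → Bool) → + count p ≡ sum (λ i → ι (p i))
count≡sum {zero}  p = refl
count≡sum {suc n} p with p zero
... | true  = cong (_+_ 1ℤ) (count≡sum (λ i → p (suc i)))
... | false = trans (count≡sum (λ i → p (suc i))) (sym (+-identityˡ _))

∑-scale : (c : ℤ) (f : Fin n → ℤ) → sum (λ i → c * f i) ≡ c * sum f
∑-scale c f = sym (*-distribˡ-sum c f)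

∑-sub : (f g : Fin n → ℤ) → sum (λ i → f i - g i) ≡ sum f - sum g
∑-sub {zero}  f g = refl
∑-sub {suc n} f g =
  trans (cong (_+_ (f zero - g zero)) (∑-sub (λ i → f (suc i)) (λ i → g (suc i))))
        (regroup (f zero) (g zero) _ _)
  where
  regroup : ∀ a b c d → a - b + (c - d) ≡ a + c - (b + d)
  regroup = solve-∀

∑-linear : (e : ℤ) (f g : Fin n → ℤ) → sum (λ i → f i - e * g i) ≡ sum f - e * sum g
∑-linear e f g = trans (∑-sub f (λ i → e * g i)) (cong (_-_ (sum f)) (∑-scale e g))

∑-const : (c : ℤ) → sum {n} (λ _ → c) ≡ + n * c
∑-const {zero}  c = refl
∑-const {suc n} c = trans (cong (_+_ c) (∑-const {n} c)) (absorb (+ n) c)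
  where
  absorb : ∀ m c → c + m * c ≡ (1ℤ + m) * c
  absorb = solve-∀

δ : Fin n → Fin n → ℤ
δ zero    zero    = 1ℤ
δ zero    (suc _) = 0ℤ
δ (suc _) zero    = 0ℤ
δ (suc x) (suc y) = δ x y

δ-diag : (x : Fin n) → δ x x ≡ 1ℤ
δ-diag zero    = refl
δ-diag (suc x) = δ-diag x

δ-off : (x y : Fin n) → x ≢ y → δ x y ≡ 0ℤ
δ-off zero    zero    x≢y = ⊥-elim (x≢y refl)
δ-off zero    (suc _) _   = refl
δ-off (suc _) zero    _   = refl
δ-off (suc x) (suc y) x≢y = δ-off x y (λ x≡y → x≢y (cong suc x≡y))

∑-δ : (x : Fin n) (f : Fin n → ℤ) → sum (λ y → δ x y * f y) ≡ f x
∑-δ zero    f = begin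
  1ℤ * f zero + sum (λ y → 0ℤ * f (suc y))  ≡⟨ cong₂ _+_ (*-identityˡ (f zero)) (∑-scale 0ℤ (λ y → f (suc y))) ⟩
  f zero + 0ℤ                               ≡⟨ +-identityʳ (f zero) ⟩
  f zero                                    ∎
∑-δ (suc x) f = begin
  0ℤ * f zero + sum (λ y → δ x y * f (suc y)) ≡⟨ +-identityˡ _ ⟩
  sum (λ y → δ x y * f (suc y))               ≡⟨ ∑-δ x (λ y → f (suc y)) ⟩
  f (suc x)                                   ∎

⟨_,_⟩ : (f g : Fin n → ℤ) → ℤ
⟨ f , g ⟩ = sum (λ i → f i * g i)

square-nat : ∀ i → Σ[ m ∈ ℕ ] i * i ≡ + m
square-nat (+ m)    = m ℕ.* m , sym (pos-* m m)
square-nat -[1+ m ] = _ , refl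

⟨f,f⟩-nat : (f : Fin n → ℤ) → Σ[ m ∈ ℕ ] ⟨ f , f ⟩ ≡ + m
⟨f,f⟩-nat {zero}  f = 0 , refl
⟨f,f⟩-nat {suc n} f with square-nat (f zero) | ⟨f,f⟩-nat (λ i → f (suc i))
... | p , e₁ | q , e₂ = p ℕ.+ q , cong₂ _+_ e₁ e₂

private
  nat-sum-zero : ∀ p q → + p + + q ≡ 0ℤ → (+ p ≡ 0ℤ) × (+ q ≡ 0ℤ)
  nat-sum-zero zero    zero    _  = refl , refl
  nat-sum-zero zero    (suc q) ()
  nat-sum-zero (suc p) q       ()

  square-zero : ∀ i → i * i ≡ 0ℤ → i ≡ 0ℤ
  square-zero i i²≡0 = [ id , id ]′ (i*j≡0⇒i≡0∨j≡0 i i²≡0)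

⟨f,f⟩≡0⇒f≡0 : (f : Fin n → ℤ) → ⟨ f , f ⟩ ≡ 0ℤ → ∀ i → f i ≡ 0ℤ
⟨f,f⟩≡0⇒f≡0 {suc n} f ⟨f,f⟩≡0 i with square-nat (f zero) | ⟨f,f⟩-nat (λ j → f (suc j))
... | p , e₁ | q , e₂ with nat-sum-zero p q (trans (sym (cong₂ _+_ e₁ e₂)) ⟨f,f⟩≡0)
⟨f,f⟩≡0⇒f≡0 {suc n} f _ zero    | p , e₁ | q , e₂ | p≡0 , _ = square-zero (f zero) (trans e₁ p≡0)
⟨f,f⟩≡0⇒f≡0 {suc n} f _ (suc i) | p , e₁ | q , e₂ | _ , q≡0 =
  ⟨f,f⟩≡0⇒f≡0 (λ j → f (suc j)) (trans e₂ q≡0) i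

vertex⇒nonempty : Fin n → + n ≢ 0ℤ
vertex⇒nonempty {suc n} _ ()

nonzero-factor : ∀ {c s} → c ≢ 0ℤ → c * s ≡ 0ℤ → s ≡ 0ℤ
nonzero-factor {c} c≢0 cs≡0 = [ (λ c≡0 → ⊥-elim (c≢0 c≡0)) , id ]′ (i*j≡0⇒i≡0∨j≡0 c cs≡0)

cancel-factor : ∀ {c d s} → c ≢ d → c * s ≡ d * s → s ≡ 0ℤ
cancel-factor {c} {d} {s} c≢d cs≡ds = nonzero-factor c-d≢0 (begin
  (c - d) * s    ≡⟨ distrib c d s ⟩
  c * s - d * s  ≡⟨ cong (_- d * s) cs≡ds ⟩
  d * s - d * s  ≡⟨ +-inverseʳ (d * s) ⟩
  0ℤ             ∎)
  where
  distrib : ∀ c d s → (c - d) * s ≡ c * s - d * s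
  distrib = solve-∀
  c-d≢0 : c - d ≢ 0ℤ
  c-d≢0 c-d≡0 = c≢d (i-j≡0⇒i≡j c d c-d≡0)

proportional-conditions : ∀ a c {P Q R S} → a ≢ 0ℤ → c ≢ 0ℤ →
  a * (P - Q) ≡ c * (R - S) → (P ≡ Q ⇔ R ≡ S)
proportional-conditions a c {P} {Q} {R} {S} a≢0 c≢0 defects = mk⇔
  (λ P≡Q → i-j≡0⇒i≡j R S (nonzero-factor c≢0 (trans (sym defects) (vanish a (i≡j⇒i-j≡0 P≡Q)))))
  (λ R≡S → i-j≡0⇒i≡j P Q (nonzero-factor a≢0 (trans defects (vanish c (i≡j⇒i-j≡0 R≡S)))))
  where
  vanish : ∀ e {t} → t ≡ 0ℤ → e * t ≡ 0ℤ
  vanish e t≡0 = trans (cong (_*_ e) t≡0) (*-zeroʳ e)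

-- If θ ≠ k is a root of x² = (λ − μ)x + (k − μ), then the vertex count k² = (k − μ) + (λ − μ)k + μv
-- together with v = 2(k − θ) forces θ = λ + μ − k, that is, v = 4k − 2λ − 2μ.
half-gap-parameters : ∀ {V K L M θ} → θ ≢ K → θ * θ ≡ (L - M) * θ + (K - M) →
  K * K ≡ (K - M) + (L - M) * K + M * V → V ≡ + 2 * (K - θ) → V ≡ + 4 * K - + 2 * L - + 2 * M
half-gap-parameters {K = K} {L} {M} {θ} θ≢K root count refl = begin
  + 2 * (K - θ)                                 ≡⟨ solve (K ∷ L ∷ M ∷ θ ∷ []) ⟩
  + 4 * K - + 2 * L - + 2 * M - + 2 * (K + θ - (L + M))
                                                ≡⟨ cong (λ s → + 4 * K - + 2 * L - + 2 * M - + 2 * s) θ≡λ+μ-k ⟩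
  + 4 * K - + 2 * L - + 2 * M - + 2 * 0ℤ        ≡⟨ solve (K ∷ L ∷ M ∷ []) ⟩
  + 4 * K - + 2 * L - + 2 * M                   ∎
  where
  θ≡λ+μ-k : K + θ - (L + M) ≡ 0ℤ
  θ≡λ+μ-k = cancel-factor (≢-sym θ≢K) (begin
    K * (K + θ - (L + M))                                          ≡⟨ solve (K ∷ L ∷ M ∷ θ ∷ []) ⟩
    K * K + K * θ - (L + M) * K                                    ≡⟨ cong (λ t → t + K * θ - (L + M) * K) count ⟩
    (K - M) + (L - M) * K + M * (+ 2 * (K - θ)) + K * θ - (L + M) * K  ≡⟨ solve (K ∷ L ∷ M ∷ θ ∷ []) ⟩
    (L - M) * θ + (K - M) + K * θ - (L + M) * θ                    ≡⟨ cong (λ t → t + K * θ - (L + M) * θ) (sym root) ⟩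
    θ * θ + K * θ - (L + M) * θ                                    ≡⟨ solve (K ∷ L ∷ M ∷ θ ∷ []) ⟩
    θ * (K + θ - (L + M))                                          ∎)

-- Arithmetic of v = 2(k − θ): a vertex with k − (v − h)/2 neighbours in H has (AF)(x) = θF(x) for
-- F = v·𝟙_H − h·𝟙, and a vertex outside H with (AF)(x) = θF(x) has h/2 neighbours in H.
half-gap-inside : ∀ V h K θ D → V ≡ + 2 * (K - θ) → + 2 * D ≡ + 2 * K - (V - h) →
  V * D - h * K ≡ θ * (V * 1ℤ - h * 1ℤ)
half-gap-inside .(+ 2 * (K - θ)) h K θ D refl balanced = *-cancelˡ-≡ (+ 2) _ _ (begin
  + 2 * (+ 2 * (K - θ) * D - h * K)                         ≡⟨ solve (h ∷ K ∷ θ ∷ D ∷ []) ⟩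
  + 2 * (K - θ) * (+ 2 * D) - + 2 * h * K                   ≡⟨ cong (λ t → + 2 * (K - θ) * t - + 2 * h * K) balanced ⟩
  + 2 * (K - θ) * (+ 2 * K - (+ 2 * (K - θ) - h)) - + 2 * h * K   ≡⟨ solve (h ∷ K ∷ θ ∷ []) ⟩
  + 2 * (θ * (+ 2 * (K - θ) * 1ℤ - h * 1ℤ))                ∎)

half-gap-outside : ∀ V h K θ D → V ≢ 0ℤ → V ≡ + 2 * (K - θ) →
  V * D - h * K ≡ θ * (V * 0ℤ - h * 1ℤ) → + 2 * D ≡ h
half-gap-outside .(+ 2 * (K - θ)) h K θ D V≢0 refl eigen = *-cancelˡ-≡ (+ 2 * (K - θ)) _ _ {{≢-nonZero V≢0}} (begin
  + 2 * (K - θ) * (+ 2 * D)                                 ≡⟨ solve (h ∷ K ∷ θ ∷ D ∷ []) ⟩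
  + 2 * (+ 2 * (K - θ) * D - h * K) + + 2 * h * K           ≡⟨ cong (λ t → + 2 * t + + 2 * h * K) eigen ⟩
  + 2 * (θ * (+ 2 * (K - θ) * 0ℤ - h * 1ℤ)) + + 2 * h * K   ≡⟨ solve (h ∷ K ∷ θ ∷ []) ⟩
  + 2 * (K - θ) * h                                         ∎)

module Adjacency {v : ℕ} (G : Graph v) where

  a : Fin v → Fin v → ℤ
  a = adjMat G

  𝟙 : Fin v → ℤ
  𝟙 _ = 1ℤ

  A : (Fin v → ℤ) → Fin v → ℤ
  A f x = sum (λ y → a x y * f y)

  a-sym : ∀ x y → a x y ≡ a y x
  a-sym x y = cong ι (adj-sym G x y)

  A-cong : {f g : Fin v → ℤ} → (∀ y → f y ≡ g y) → ∀ x → A f x ≡ A g x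
  A-cong f≗g x = sum-cong-≗ (λ y → cong (_*_ (a x y)) (f≗g y))

  A-scale : (c : ℤ) (f : Fin v → ℤ) → ∀ x → A (λ y → c * f y) x ≡ c * A f x
  A-scale c f x = trans (sum-cong-≗ (λ y → swap (a x y) c (f y))) (∑-scale c (λ y → a x y * f y))
    where
    swap : ∀ p c q → p * (c * q) ≡ c * (p * q)
    swap = solve-∀

  A-linear : (e : ℤ) (f g : Fin v → ℤ) → ∀ x → A (λ y → f y - e * g y) x ≡ A f x - e * A g x
  A-linear e f g x = trans (sum-cong-≗ (λ y → distrib (a x y) (f y) e (g y)))
                           (∑-linear e (λ y → a x y * f y) (λ y → a x y * g y))
    where
    distrib : ∀ p q e r → p * (q - e * r) ≡ p * q - e * (p * r)
    distrib = solve-∀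

  degree≡ : ∀ x → + degree G x ≡ sum (a x)
  degree≡ x = count≡sum (adj G x)

  commonNbrs≡ : ∀ x y → + commonNbrs G x y ≡ sum (λ z → a x z * a z y)
  commonNbrs≡ x y = trans (count≡sum (λ z → adj G x z ∧ adj G y z))
    (sum-cong-≗ (λ z → trans (ι-∧ (adj G x z) (adj G y z)) (cong (_*_ (a x z)) (a-sym y z))))

  centred-indicator : (Fin v → Bool) → Fin v → ℤ
  centred-indicator H y = + v * ι (H y) - + count H * 1ℤ

  ∑-centred-indicator : (H : Fin v → Bool) → sum (centred-indicator H) ≡ 0ℤ
  ∑-centred-indicator H = begin
    sum (centred-indicator H)                                    ≡⟨ ∑-linear h (λ y → + v * ι (H y)) 𝟙 ⟩
    sum (λ y → + v * ι (H y)) - h * sum 𝟙                        ≡⟨ cong₂ (λ s t → s - h * t) ∑v𝟙_H (∑-const {v} 1ℤ) ⟩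
    + v * h - h * (+ v * 1ℤ)                                     ≡⟨ cancel (+ v) h ⟩
    0ℤ                                                           ∎
    where
    h : ℤ
    h = + count H
    ∑v𝟙_H : sum (λ y → + v * ι (H y)) ≡ + v * h
    ∑v𝟙_H = trans (∑-scale (+ v) (λ y → ι (H y))) (cong (_*_ (+ v)) (sym (count≡sum H)))
    cancel : ∀ V h → V * h - h * (V * 1ℤ) ≡ 0ℤ
    cancel = solve-∀

  A-indicator : (H : Fin v → Bool) → ∀ x → A (λ y → ι (H y)) x ≡ + inducedDegree G H x
  A-indicator H x = trans (sum-cong-≗ (λ y → trans (*-comm (a x y) (ι (H y))) (sym (ι-∧ (H y) (adj G x y)))))
                          (sym (count≡sum (λ y → H y ∧ adj G x y)))

  A-selfadjoint : (f g : Fin v → ℤ) → ⟨ A f , g ⟩ ≡ ⟨ f , A g ⟩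
  A-selfadjoint f g = begin
    sum (λ x → A f x * g x)                         ≡⟨ sum-cong-≗ (λ x → *-distribʳ-sum (g x) (λ y → a x y * f y)) ⟩
    sum (λ x → sum (λ y → a x y * f y * g x))       ≡⟨ ∑-comm (λ x y → a x y * f y * g x) ⟩
    sum (λ y → sum (λ x → a x y * f y * g x))       ≡⟨ sum-cong-≗ (λ y → trans (sum-cong-≗ (λ x → regroup y x))
                                                                               (∑-scale (f y) (λ x → a y x * g x))) ⟩
    sum (λ y → f y * A g y)                         ∎
    where
    rearrange : ∀ p q r → p * q * r ≡ q * (p * r)
    rearrange = solve-∀
    regroup : ∀ y x → a x y * f y * g x ≡ f y * (a y x * g x)
    regroup y x = trans (rearrange (a x y) (f y) (g x)) (cong (λ p → f y * (p * g x)) (a-sym x y))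

  A²≡commonNbrs : (f : Fin v → ℤ) → ∀ x → A (A f) x ≡ sum (λ y → + commonNbrs G x y * f y)
  A²≡commonNbrs f x = begin
    sum (λ z → a x z * sum (λ y → a z y * f y))     ≡⟨ sum-cong-≗ (λ z → *-distribˡ-sum (a x z) (λ y → a z y * f y)) ⟩
    sum (λ z → sum (λ y → a x z * (a z y * f y)))   ≡⟨ ∑-comm (λ z y → a x z * (a z y * f y)) ⟩
    sum (λ y → sum (λ z → a x z * (a z y * f y)))   ≡⟨ sum-cong-≗ (λ y → pull-out y) ⟩
    sum (λ y → + commonNbrs G x y * f y)            ∎
    where
    pull-out : ∀ y → sum (λ z → a x z * (a z y * f y)) ≡ + commonNbrs G x y * f y
    pull-out y = begin
      sum (λ z → a x z * (a z y * f y))   ≡⟨ sum-cong-≗ (λ z → sym (*-assoc (a x z) (a z y) (f y))) ⟩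
      sum (λ z → a x z * a z y * f y)     ≡⟨ sym (*-distribʳ-sum (f y) (λ z → a x z * a z y)) ⟩
      sum (λ z → a x z * a z y) * f y     ≡⟨ cong (_* f y) (sym (commonNbrs≡ x y)) ⟩
      + commonNbrs G x y * f y            ∎

  module Regular (k : ℕ) (regular : ∀ x → degree G x ≡ k) where

    A-ones : ∀ x → A 𝟙 x ≡ + k
    A-ones x = trans (sum-cong-≗ (λ y → *-identityʳ (a x y)))
                     (trans (sym (degree≡ x)) (cong +_ (regular x)))

    ∑-A : (f : Fin v → ℤ) → sum (A f) ≡ + k * sum f
    ∑-A f = begin
      sum (A f)                     ≡⟨ sum-cong-≗ (λ x → sym (*-identityʳ (A f x))) ⟩
      ⟨ A f , 𝟙 ⟩                   ≡⟨ A-selfadjoint f 𝟙 ⟩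
      ⟨ f , A 𝟙 ⟩                   ≡⟨ sum-cong-≗ (λ y → trans (cong (_*_ (f y)) (A-ones y)) (*-comm (f y) (+ k))) ⟩
      sum (λ y → + k * f y)         ≡⟨ ∑-scale (+ k) f ⟩
      + k * sum f                   ∎

    A-centred-indicator : (H : Fin v → Bool) → ∀ x →
      A (centred-indicator H) x ≡ + v * + inducedDegree G H x - + count H * + k
    A-centred-indicator H x = begin
      A (centred-indicator H) x                                   ≡⟨ A-linear h (λ y → + v * ι (H y)) 𝟙 x ⟩
      A (λ y → + v * ι (H y)) x - h * A 𝟙 x                       ≡⟨ cong₂ _-_ Av𝟙_H (cong (_*_ h) (A-ones x)) ⟩
      + v * + inducedDegree G H x - h * + k                       ∎
      where
      h : ℤ
      h = + count H
      Av𝟙_H : A (λ y → + v * ι (H y)) x ≡ + v * + inducedDegree G H x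
      Av𝟙_H = trans (A-scale (+ v) (λ y → ι (H y)) x) (cong (_*_ (+ v)) (A-indicator H x))

  module StronglyRegular (k lam mu : ℕ) (srg : IsSRG G k lam mu) where

    open Regular k (proj₁ srg) public

    K L M V : ℤ
    K = + k
    L = + lam
    M = + mu
    V = + v

    commonNbrs-formula : ∀ x y → + commonNbrs G x y ≡ (K - M) * δ x y + (L - M) * a x y + M
    commonNbrs-formula x y with x ≟ᶠ y
    ... | yes refl = begin
      + commonNbrs G x x                      ≡⟨ commonNbrs≡ x x ⟩
      sum (λ z → a x z * a z x)               ≡⟨ sum-cong-≗ (λ z → trans (cong (_*_ (a x z)) (a-sym z x)) (ι-idem (adj G x z))) ⟩
      sum (a x)                               ≡⟨ sym (degree≡ x) ⟩
      + degree G x                            ≡⟨ cong +_ (proj₁ srg x) ⟩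
      K                                       ≡⟨ diagonal K L M ⟩
      (K - M) * 1ℤ + (L - M) * 0ℤ + M         ≡⟨ cong₂ (λ d e → (K - M) * d + (L - M) * e + M) (sym (δ-diag x)) (cong ι (sym (loopless G x))) ⟩
      (K - M) * δ x x + (L - M) * a x x + M   ∎
      where
      diagonal : ∀ K L M → K ≡ (K - M) * 1ℤ + (L - M) * 0ℤ + M
      diagonal = solve-∀
    ... | no x≢y with adj G x y in x~y
    ...   | true = begin
      + commonNbrs G x y                      ≡⟨ cong +_ (proj₁ (proj₂ srg) x y x≢y x~y) ⟩
      L                                       ≡⟨ adjacent K L M ⟩
      (K - M) * 0ℤ + (L - M) * 1ℤ + M         ≡⟨ cong (λ d → (K - M) * d + (L - M) * 1ℤ + M) (sym (δ-off x y x≢y)) ⟩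
      (K - M) * δ x y + (L - M) * 1ℤ + M      ∎
      where
      adjacent : ∀ K L M → L ≡ (K - M) * 0ℤ + (L - M) * 1ℤ + M
      adjacent = solve-∀
    ...   | false = begin
      + commonNbrs G x y                      ≡⟨ cong +_ (proj₂ (proj₂ srg) x y x≢y x~y) ⟩
      M                                       ≡⟨ nonadjacent K L M ⟩
      (K - M) * 0ℤ + (L - M) * 0ℤ + M         ≡⟨ cong (λ d → (K - M) * d + (L - M) * 0ℤ + M) (sym (δ-off x y x≢y)) ⟩
      (K - M) * δ x y + (L - M) * 0ℤ + M      ∎
      where
      nonadjacent : ∀ K L M → M ≡ (K - M) * 0ℤ + (L - M) * 0ℤ + M
      nonadjacent = solve-∀

    A²-srg : (f : Fin v → ℤ) → ∀ x → A (A f) x ≡ (K - M) * f x + (L - M) * A f x + M * sum f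
    A²-srg f x = begin
      A (A f) x
        ≡⟨ A²≡commonNbrs f x ⟩
      sum (λ y → + commonNbrs G x y * f y)
        ≡⟨ sum-cong-≗ (λ y → trans (cong (_* f y) (commonNbrs-formula x y)) (expand K L M (δ x y) (a x y) (f y))) ⟩
      sum (λ y → (K - M) * (δ x y * f y) + (L - M) * (a x y * f y) + M * f y)
        ≡⟨ ∑-distrib-+ (λ y → (K - M) * (δ x y * f y) + (L - M) * (a x y * f y)) (λ y → M * f y) ⟩
      sum (λ y → (K - M) * (δ x y * f y) + (L - M) * (a x y * f y)) + sum (λ y → M * f y)
        ≡⟨ cong₂ _+_ (∑-distrib-+ (λ y → (K - M) * (δ x y * f y)) (λ y → (L - M) * (a x y * f y))) (∑-scale M f) ⟩
      sum (λ y → (K - M) * (δ x y * f y)) + sum (λ y → (L - M) * (a x y * f y)) + M * sum f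
        ≡⟨ cong (_+ M * sum f) (cong₂ _+_ (trans (∑-scale (K - M) (λ y → δ x y * f y)) (cong (_*_ (K - M)) (∑-δ x f)))
                                           (∑-scale (L - M) (λ y → a x y * f y))) ⟩
      (K - M) * f x + (L - M) * A f x + M * sum f
        ∎
      where
      expand : ∀ K L M d e w → ((K - M) * d + (L - M) * e + M) * w ≡ (K - M) * (d * w) + (L - M) * (e * w) + M * w
      expand = solve-∀

    Root : ℤ → Set
    Root θ = θ * θ ≡ (L - M) * θ + (K - M)

    -- An eigenvector u for θ ≠ k is orthogonal to 𝟙, so A²u = (k − μ)u + (λ − μ)Au forces Root θ.
    eigenvalue-root : (θ : ℤ) → IsEigenvalue G θ → θ ≢ K → Root θ
    eigenvalue-root θ (u , u≢0 , eigen) θ≢K with θ * θ ≟ (L - M) * θ + (K - M)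
    ... | yes root = root
    ... | no ¬root = ⊥-elim (u≢0 (λ x → cancel-factor ¬root (root-defect x)))
      where
      Au≡θu : ∀ x → A u x ≡ θ * u x
      Au≡θu x = trans (sym (sumℤ≡sum (λ y → a x y * u y))) (eigen x)
      ∑u≡0 : sum u ≡ 0ℤ
      ∑u≡0 = cancel-factor (≢-sym θ≢K) (trans (sym (∑-A u)) (trans (sum-cong-≗ Au≡θu) (∑-scale θ u)))
      root-defect : ∀ x → θ * θ * u x ≡ ((L - M) * θ + (K - M)) * u x
      root-defect x = begin
        θ * θ * u x                                      ≡⟨ *-assoc θ θ (u x) ⟩
        θ * (θ * u x)                                    ≡⟨ cong (_*_ θ) (sym (Au≡θu x)) ⟩
        θ * A u x                                        ≡⟨ sym (A-scale θ u x) ⟩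
        A (λ y → θ * u y) x                              ≡⟨ sym (A-cong Au≡θu x) ⟩
        A (A u) x                                        ≡⟨ A²-srg u x ⟩
        (K - M) * u x + (L - M) * A u x + M * sum u      ≡⟨ cong₂ (λ p s → (K - M) * u x + (L - M) * p + M * s) (Au≡θu x) ∑u≡0 ⟩
        (K - M) * u x + (L - M) * (θ * u x) + M * 0ℤ     ≡⟨ collect K L M θ (u x) ⟩
        ((L - M) * θ + (K - M)) * u x                    ∎
        where
        collect : ∀ K L M θ w → (K - M) * w + (L - M) * (θ * w) + M * 0ℤ ≡ ((L - M) * θ + (K - M)) * w
        collect = solve-∀

    -- Counting walks of length two from any vertex: k² = (k − μ) + (λ − μ)k + μv.
    vertex-count : Fin v → K * K ≡ (K - M) + (L - M) * K + M * V
    vertex-count x = begin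
      K * K                                        ≡⟨ cong (_*_ K) (sym (A-ones x)) ⟩
      K * A 𝟙 x                                    ≡⟨ sym (A-scale K 𝟙 x) ⟩
      A (λ _ → K * 1ℤ) x                           ≡⟨ A-cong (λ y → trans (*-identityʳ K) (sym (A-ones y))) x ⟩
      A (A 𝟙) x                                    ≡⟨ A²-srg 𝟙 x ⟩
      (K - M) * 1ℤ + (L - M) * A 𝟙 x + M * sum 𝟙 ≡⟨ cong₂ (λ p s → (K - M) * 1ℤ + (L - M) * p + M * s) (A-ones x) (∑-const {v} 1ℤ) ⟩
      (K - M) * 1ℤ + (L - M) * K + M * (V * 1ℤ)    ≡⟨ tidy K L M V ⟩
      (K - M) + (L - M) * K + M * V                ∎
      where
      tidy : ∀ K L M V → (K - M) * 1ℤ + (L - M) * K + M * (V * 1ℤ) ≡ (K - M) + (L - M) * K + M * V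
      tidy = solve-∀

    -- Let θ be a root and F ⊥ 𝟙.  If the defect g = AF − θF vanishes
    -- wherever F differs from a constant c, then g = 0.  Indeed Ag = (λ − μ − θ)g, ⟨F , g⟩ = c·Σg = 0,
    -- hence ⟨g , g⟩ = ⟨F , Ag⟩ − θ⟨F , g⟩ = 0 by self-adjointness.
    eigenvector-completion : (θ : ℤ) → Root θ → (F : Fin v → ℤ) → sum F ≡ 0ℤ → (c : ℤ) →
      (∀ x → A F x ≡ θ * F x ⊎ F x ≡ c) → ∀ x → A F x ≡ θ * F x
    eigenvector-completion θ root F ∑F≡0 c defect-or-constant x =
      i-j≡0⇒i≡j (A F x) (θ * F x) (⟨f,f⟩≡0⇒f≡0 g ⟨g,g⟩≡0 x)
      where
      g : Fin v → ℤ
      g y = A F y - θ * F y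

      Ag≡θ′g : ∀ y → A g y ≡ (L - M - θ) * g y
      Ag≡θ′g y = begin
        A g y                                                     ≡⟨ A-linear θ (A F) F y ⟩
        A (A F) y - θ * A F y                                     ≡⟨ cong (_- θ * A F y) (A²-srg F y) ⟩
        (K - M) * F y + (L - M) * A F y + M * sum F - θ * A F y   ≡⟨ cong (λ s → (K - M) * F y + (L - M) * A F y + M * s - θ * A F y) ∑F≡0 ⟩
        (K - M) * F y + (L - M) * A F y + M * 0ℤ - θ * A F y      ≡⟨ regroup K L M θ (F y) (A F y) ⟩
        (L - M - θ) * A F y + ((L - M) * θ + (K - M) - (L - M) * θ) * F y
                                                                  ≡⟨ cong (λ t → (L - M - θ) * A F y + (t - (L - M) * θ) * F y) (sym root) ⟩
        (L - M - θ) * A F y + (θ * θ - (L - M) * θ) * F y         ≡⟨ factor L M θ (F y) (A F y) ⟩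
        (L - M - θ) * g y                                         ∎
        where
        regroup : ∀ K L M θ f p → (K - M) * f + (L - M) * p + M * 0ℤ - θ * p ≡
                                  (L - M - θ) * p + ((L - M) * θ + (K - M) - (L - M) * θ) * f
        regroup = solve-∀
        factor : ∀ L M θ f p → (L - M - θ) * p + (θ * θ - (L - M) * θ) * f ≡ (L - M - θ) * (p - θ * f)
        factor = solve-∀

      Fg≡cg : ∀ y → F y * g y ≡ c * g y
      Fg≡cg y with defect-or-constant y
      ... | inj₁ eigen = begin
        F y * g y   ≡⟨ cong (_*_ (F y)) g≡0 ⟩
        F y * 0ℤ    ≡⟨ *-zeroʳ (F y) ⟩
        0ℤ          ≡⟨ sym (*-zeroʳ c) ⟩
        c * 0ℤ      ≡⟨ cong (_*_ c) (sym g≡0) ⟩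
        c * g y     ∎
        where
        g≡0 : g y ≡ 0ℤ
        g≡0 = i≡j⇒i-j≡0 eigen
      ... | inj₂ F≡c = cong (_* g y) F≡c

      ⟨F,g⟩≡0 : ⟨ F , g ⟩ ≡ 0ℤ
      ⟨F,g⟩≡0 = begin
        ⟨ F , g ⟩                    ≡⟨ sum-cong-≗ Fg≡cg ⟩
        sum (λ y → c * g y)          ≡⟨ ∑-scale c g ⟩
        c * sum g                    ≡⟨ cong (_*_ c) (∑-linear θ (A F) F) ⟩
        c * (sum (A F) - θ * sum F)  ≡⟨ cong (λ s → c * (s - θ * sum F)) (∑-A F) ⟩
        c * (K * sum F - θ * sum F)  ≡⟨ cong (λ s → c * (K * s - θ * s)) ∑F≡0 ⟩
        c * (K * 0ℤ - θ * 0ℤ)        ≡⟨ vanish c K θ ⟩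
        0ℤ                           ∎
        where
        vanish : ∀ c K θ → c * (K * 0ℤ - θ * 0ℤ) ≡ 0ℤ
        vanish = solve-∀

      ⟨g,g⟩≡0 : ⟨ g , g ⟩ ≡ 0ℤ
      ⟨g,g⟩≡0 = begin
        ⟨ g , g ⟩                                   ≡⟨ sum-cong-≗ (λ y → distrib (A F y) θ (F y) (g y)) ⟩
        sum (λ y → A F y * g y - θ * (F y * g y))   ≡⟨ ∑-linear θ (λ y → A F y * g y) (λ y → F y * g y) ⟩
        ⟨ A F , g ⟩ - θ * ⟨ F , g ⟩                 ≡⟨ cong (_- θ * ⟨ F , g ⟩) (A-selfadjoint F g) ⟩
        ⟨ F , A g ⟩ - θ * ⟨ F , g ⟩                 ≡⟨ cong (_- θ * ⟨ F , g ⟩) (sum-cong-≗ (λ y → trans (cong (_*_ (F y)) (Ag≡θ′g y)) (swap (F y) (L - M - θ) (g y)))) ⟩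
        sum (λ y → (L - M - θ) * (F y * g y)) - θ * ⟨ F , g ⟩
                                                    ≡⟨ cong (_- θ * ⟨ F , g ⟩) (∑-scale (L - M - θ) (λ y → F y * g y)) ⟩
        (L - M - θ) * ⟨ F , g ⟩ - θ * ⟨ F , g ⟩     ≡⟨ cong (λ s → (L - M - θ) * s - θ * s) ⟨F,g⟩≡0 ⟩
        (L - M - θ) * 0ℤ - θ * 0ℤ                   ≡⟨ vanish (L - M - θ) θ ⟩
        0ℤ                                          ∎
        where
        distrib : ∀ p θ f q → (p - θ * f) * q ≡ p * q - θ * (f * q)
        distrib = solve-∀
        swap : ∀ f s q → f * (s * q) ≡ s * (f * q)
        swap = solve-∀
        vanish : ∀ s θ → s * 0ℤ - θ * 0ℤ ≡ 0ℤ
        vanish = solve-∀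

    -- Suppose v = 2(k − θ) for a root θ and every vertex of H has exactly
    -- k − (v − h)/2 neighbours in H.  Then F = v·𝟙_H − h·𝟙 satisfies AF = θF on H and equals −h off H,
    -- so by eigenvector completion AF = θF everywhere, i.e. every vertex outside H has h/2 neighbours in H.
    balance-propagates : (θ : ℤ) → Root θ → V ≡ + 2 * (K - θ) → (H : Fin v → Bool) →
      (∀ x → H x ≡ true → + 2 * + inducedDegree G H x ≡ + 2 * K - (V - + count H)) →
      ∀ x → H x ≡ false → + 2 * + inducedDegree G H x ≡ + count H
    balance-propagates θ root V≡2[K-θ] H balanced-on-H x x∉H =
      half-gap-outside V h K θ (dH x) (vertex⇒nonempty x) V≡2[K-θ] (begin
        V * dH x - h * K                ≡⟨ sym (A-centred-indicator H x) ⟩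
        A F x                           ≡⟨ eigenvector-completion θ root F (∑-centred-indicator H) (- h) on-H-or-constant x ⟩
        θ * F x                         ≡⟨ cong (λ b → θ * (V * ι b - h * 1ℤ)) x∉H ⟩
        θ * (V * 0ℤ - h * 1ℤ)           ∎)
      where
      h : ℤ
      h = + count H
      dH F : Fin v → ℤ
      dH y = + inducedDegree G H y
      F = centred-indicator H

      on-H-or-constant : ∀ y → A F y ≡ θ * F y ⊎ F y ≡ - h
      on-H-or-constant y = by-membership (H y) refl
        where
        by-membership : ∀ b → H y ≡ b → A F y ≡ θ * F y ⊎ F y ≡ - h
        by-membership true y∈H = inj₁ (begin
          A F y                           ≡⟨ A-centred-indicator H y ⟩
          V * dH y - h * K                ≡⟨ half-gap-inside V h K θ (dH y) V≡2[K-θ] (balanced-on-H y y∈H) ⟩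
          θ * (V * 1ℤ - h * 1ℤ)           ≡⟨ cong (λ b → θ * (V * ι b - h * 1ℤ)) (sym y∈H) ⟩
          θ * F y                         ∎)
        by-membership false y∉H = inj₂ (trans (cong (λ b → V * ι b - h * 1ℤ) y∉H) (constant V h))
          where
          constant : ∀ V h → V * 0ℤ - h * 1ℤ ≡ - h
          constant = solve-∀

eigenvector-vertex : ∀ {v} (G : Graph v) (θ : ℤ) → IsEigenvalue G θ → Fin v
eigenvector-vertex {zero}  _ _ (u , u≢0 , _) = ⊥-elim (u≢0 (λ ()))
eigenvector-vertex {suc v} _ _ _             = zero

σ : Bool → ℤ
σ b = 1ℤ - + 2 * ι b

σ-xor : ∀ p q → σ (p xor q) ≡ σ p * σ q
σ-xor true  true  = refl
σ-xor true  false = refl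
σ-xor false true  = refl
σ-xor false false = refl

σ-square : ∀ b → σ b * σ b ≡ 1ℤ
σ-square true  = refl
σ-square false = refl

∑σ : (p : Fin n → Bool) → sum (λ z → σ (p z)) ≡ + n - + 2 * + count p
∑σ {n} p = begin
  sum (λ z → 1ℤ - + 2 * ι (p z))              ≡⟨ ∑-linear (+ 2) (λ _ → 1ℤ) (λ z → ι (p z)) ⟩
  sum {n} (λ _ → 1ℤ) - + 2 * sum (λ z → ι (p z))
                                              ≡⟨ cong₂ (λ s t → s - + 2 * t) (trans (∑-const {n} 1ℤ) (*-identityʳ (+ n))) (sym (count≡sum p)) ⟩
  + n - + 2 * + count p                       ∎

∑σσ : (p q : Fin n → Bool) → sum (λ z → σ (p z) * σ (q z)) ≡
  + n - + 2 * + count p - + 2 * + count q + + 4 * + count (λ z → p z ∧ q z)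
∑σσ {n} p q = begin
  sum (λ z → σ (p z) * σ (q z))
    ≡⟨ sum-cong-≗ (λ z → trans (expand (ι (p z)) (ι (q z))) (cong (λ t → σ (p z) - + 2 * (ι (q z) - + 2 * t)) (sym (ι-∧ (p z) (q z))))) ⟩
  sum (λ z → σ (p z) - + 2 * (ι (q z) - + 2 * ι (p z ∧ q z)))
    ≡⟨ ∑-linear (+ 2) (λ z → σ (p z)) (λ z → ι (q z) - + 2 * ι (p z ∧ q z)) ⟩
  sum (λ z → σ (p z)) - + 2 * sum (λ z → ι (q z) - + 2 * ι (p z ∧ q z))
    ≡⟨ cong₂ (λ s t → s - + 2 * t) (∑σ p) (∑-linear (+ 2) (λ z → ι (q z)) (λ z → ι (p z ∧ q z))) ⟩
  (+ n - + 2 * + count p) - + 2 * (sum (λ z → ι (q z)) - + 2 * sum (λ z → ι (p z ∧ q z)))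
    ≡⟨ cong₂ (λ s t → (+ n - + 2 * + count p) - + 2 * (s - + 2 * t)) (sym (count≡sum q)) (sym (count≡sum (λ z → p z ∧ q z))) ⟩
  (+ n - + 2 * + count p) - + 2 * (+ count q - + 2 * + count (λ z → p z ∧ q z))
    ≡⟨ tidy (+ n) (+ count p) (+ count q) (+ count (λ z → p z ∧ q z)) ⟩
  + n - + 2 * + count p - + 2 * + count q + + 4 * + count (λ z → p z ∧ q z)
    ∎
  where
  expand : ∀ s t → (1ℤ - + 2 * s) * (1ℤ - + 2 * t) ≡ (1ℤ - + 2 * s) - + 2 * (t - + 2 * (s * t))
  expand = solve-∀
  tidy : ∀ N P Q R → (N - + 2 * P) - + 2 * (Q - + 2 * R) ≡ N - + 2 * P - + 2 * Q + + 4 * R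
  tidy = solve-∀

signedWalks : ∀ {v} → Graph v → Fin v → Fin v → ℤ
signedWalks G x y = sum (λ z → σ (adj G x z) * σ (adj G z y))

signedWalks≡ : ∀ {v} (G : Graph v) x y → signedWalks G x y ≡
  + v - + 2 * + degree G x - + 2 * + degree G y + + 4 * + commonNbrs G x y
signedWalks≡ G x y = trans (sum-cong-≗ (λ z → cong (λ b → σ (adj G x z) * σ b) (adj-sym G z y)))
                           (∑σσ (adj G x) (adj G y))

-- The signed-walk form of the λ/μ conditions.
WalkCondition : ∀ {v} → Graph v → ℕ → ℕ → Set
WalkCondition G lam mu = ∀ x y → x ≢ y → signedWalks G x y ≡ + 2 * (+ mu - + lam) * σ (adj G x y)

walk-criterion : ∀ {v} (G : Graph v) {k lam mu} → (∀ x → degree G x ≡ k) →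
  + v ≡ + 4 * + k - + 2 * + lam - + 2 * + mu → ∀ x y →
  (commonNbrs G x y ≡ (if adj G x y then lam else mu) ⇔
   signedWalks G x y ≡ + 2 * (+ mu - + lam) * σ (adj G x y))
walk-criterion {v} G {k} {lam} {mu} regular relation x y =
  proportional-conditions (+ 4) 1ℤ (λ ()) (λ ())
    (trans (cong (λ t → + 4 * (C - t)) (if-float +_ (adj G x y)))
           (defects (adj G x y) (+ k) (+ lam) (+ mu) (+ v) W C relation W≡))
  ⇔-∘ mk⇔ (cong (λ m → + m)) +-injective
  where
  C W : ℤ
  C = + commonNbrs G x y
  W = signedWalks G x y
  W≡ : W ≡ + v - + 2 * + k - + 2 * + k + + 4 * C
  W≡ = trans (signedWalks≡ G x y)
             (cong₂ (λ d e → + v - + 2 * d - + 2 * e + + 4 * C) (cong +_ (regular x)) (cong +_ (regular y)))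
  defects : ∀ b K L M V W C → V ≡ + 4 * K - + 2 * L - + 2 * M → W ≡ V - + 2 * K - + 2 * K + + 4 * C →
            + 4 * (C - (if b then L else M)) ≡ 1ℤ * (W - + 2 * (M - L) * σ b)
  defects true  K L M _ _ C refl refl = adjacent K L M C
    where
    adjacent : ∀ K L M C → + 4 * (C - L) ≡
      1ℤ * (+ 4 * K - + 2 * L - + 2 * M - + 2 * K - + 2 * K + + 4 * C - + 2 * (M - L) * σ true)
    adjacent = solve-∀
  defects false K L M _ _ C refl refl = nonadjacent K L M C
    where
    nonadjacent : ∀ K L M C → + 4 * (C - M) ≡
      1ℤ * (+ 4 * K - + 2 * L - + 2 * M - + 2 * K - + 2 * K + + 4 * C - + 2 * (M - L) * σ false)
    nonadjacent = solve-∀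

srg⇒walks : ∀ {v} (G : Graph v) {k lam mu} → IsSRG G k lam mu →
  + v ≡ + 4 * + k - + 2 * + lam - + 2 * + mu → WalkCondition G lam mu
srg⇒walks G {k} {lam} {mu} (regular , adjacent , nonadjacent) relation x y x≢y =
  Equivalence.to (walk-criterion G regular relation x y) (by-adjacency (adj G x y) refl)
  where
  by-adjacency : ∀ b → adj G x y ≡ b → commonNbrs G x y ≡ (if adj G x y then lam else mu)
  by-adjacency true  x~y = trans (adjacent x y x≢y x~y) (cong (λ b → if b then lam else mu) (sym x~y))
  by-adjacency false x≁y = trans (nonadjacent x y x≢y x≁y) (cong (λ b → if b then lam else mu) (sym x≁y))

walks⇒srg : ∀ {v} (G : Graph v) {k lam mu} → (∀ x → degree G x ≡ k) →
  + v ≡ + 4 * + k - + 2 * + lam - + 2 * + mu → WalkCondition G lam mu → IsSRG G k lam mu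
walks⇒srg G {k} {lam} {mu} regular relation walks = regular , adjacent , nonadjacent
  where
  by-adjacency : ∀ x y → x ≢ y → commonNbrs G x y ≡ (if adj G x y then lam else mu)
  by-adjacency x y x≢y = Equivalence.from (walk-criterion G regular relation x y) (walks x y x≢y)
  adjacent : ∀ x y → x ≢ y → adj G x y ≡ true → commonNbrs G x y ≡ lam
  adjacent x y x≢y x~y = trans (by-adjacency x y x≢y) (cong (λ b → if b then lam else mu) x~y)
  nonadjacent : ∀ x y → x ≢ y → adj G x y ≡ false → commonNbrs G x y ≡ mu
  nonadjacent x y x≢y x≁y = trans (by-adjacency x y x≢y) (cong (λ b → if b then lam else mu) x≁y)

module Switching {v : ℕ} (G : Graph v) (H : Fin v → Bool) where

  G′ : Graph v
  G′ = switch G H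

  h : ℤ
  h = + count H

  switched-sign : ∀ x y → σ (adj G′ x y) ≡ σ (H x) * σ (H y) * σ (adj G x y)
  switched-sign x y = trans (σ-xor (adj G x y) (H x xor H y))
    (trans (cong (_*_ (σ (adj G x y))) (σ-xor (H x) (H y))) (*-comm (σ (adj G x y)) (σ (H x) * σ (H y))))

  switched-degree : ∀ x → + v - + 2 * + degree G′ x ≡
    σ (H x) * (+ v - + 2 * h - + 2 * + degree G x + + 4 * + inducedDegree G H x)
  switched-degree x = begin
    + v - + 2 * + degree G′ x                          ≡⟨ sym (∑σ (adj G′ x)) ⟩
    sum (λ y → σ (adj G′ x y))                         ≡⟨ sum-cong-≗ (λ y → trans (switched-sign x y) (*-assoc (σ (H x)) (σ (H y)) _)) ⟩
    sum (λ y → σ (H x) * (σ (H y) * σ (adj G x y)))    ≡⟨ ∑-scale (σ (H x)) (λ y → σ (H y) * σ (adj G x y)) ⟩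
    σ (H x) * sum (λ y → σ (H y) * σ (adj G x y))      ≡⟨ cong (_*_ (σ (H x))) (∑σσ H (adj G x)) ⟩
    σ (H x) * (+ v - + 2 * h - + 2 * + degree G x + + 4 * + inducedDegree G H x) ∎

  -- The number of H-neighbours that keeps the degree of a vertex unchanged, inside and outside H.
  balance : Bool → ℤ → ℤ
  balance true  d = + 2 * d - (+ v - h)
  balance false d = h

  degree-preserved : ∀ x →
    (degree G′ x ≡ degree G x ⇔ + 2 * + inducedDegree G H x ≡ balance (H x) (+ degree G x))
  degree-preserved x =
    proportional-conditions (+ 2) (- (+ 2 * σ (H x))) (λ ()) (factor≢0 (H x)) (begin
      + 2 * (D′ - D)                    ≡⟨ regroup (+ v) D D′ ⟩
      (+ v - + 2 * D) - (+ v - + 2 * D′) ≡⟨ cong (_-_ (+ v - + 2 * D)) (switched-degree x) ⟩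
      (+ v - + 2 * D) - σ (H x) * (+ v - + 2 * h - + 2 * D + + 4 * dH)
                                        ≡⟨ shift (H x) D dH ⟩
      - (+ 2 * σ (H x)) * (+ 2 * dH - balance (H x) D) ∎)
    ⇔-∘ mk⇔ (cong (λ m → + m)) +-injective
    where
    D D′ dH : ℤ
    D  = + degree G x
    D′ = + degree G′ x
    dH = + inducedDegree G H x
    factor≢0 : ∀ b → - (+ 2 * σ b) ≢ 0ℤ
    factor≢0 true  ()
    factor≢0 false ()
    regroup : ∀ V D D′ → + 2 * (D′ - D) ≡ (V - + 2 * D) - (V - + 2 * D′)
    regroup = solve-∀
    shift : ∀ b D dH → (+ v - + 2 * D) - σ b * (+ v - + 2 * h - + 2 * D + + 4 * dH) ≡
            - (+ 2 * σ b) * (+ 2 * dH - balance b D)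
    shift true  = inside (+ v) h
      where
      inside : ∀ V h D dH → (V - + 2 * D) - σ true * (V - + 2 * h - + 2 * D + + 4 * dH) ≡
               - (+ 2 * σ true) * (+ 2 * dH - (+ 2 * D - (V - h)))
      inside = solve-∀
    shift false = outside (+ v) h
      where
      outside : ∀ V h D dH → (V - + 2 * D) - σ false * (V - + 2 * h - + 2 * D + + 4 * dH) ≡
                - (+ 2 * σ false) * (+ 2 * dH - h)
      outside = solve-∀

  balanced-everywhere :
    (∀ x → H x ≡ true → + 2 * + inducedDegree G H x ≡ balance true (+ degree G x)) →
    (∀ x → H x ≡ false → + 2 * + inducedDegree G H x ≡ h) →
    ∀ x → + 2 * + inducedDegree G H x ≡ balance (H x) (+ degree G x)
  balanced-everywhere inside outside x = by-membership (H x) refl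
    where
    by-membership : ∀ b → H x ≡ b → + 2 * + inducedDegree G H x ≡ balance (H x) (+ degree G x)
    by-membership true  x∈H = trans (inside x x∈H) (cong (λ b → balance b (+ degree G x)) (sym x∈H))
    by-membership false x∉H = trans (outside x x∉H) (cong (λ b → balance b (+ degree G x)) (sym x∉H))

  -- Switching multiplies signed walk counts by σ(H x)σ(H y), since σ(H z)² = 1.
  switched-walks : ∀ x y → signedWalks G′ x y ≡ σ (H x) * σ (H y) * signedWalks G x y
  switched-walks x y = begin
    sum (λ z → σ (adj G′ x z) * σ (adj G′ z y))
      ≡⟨ sum-cong-≗ pointwise ⟩
    sum (λ z → σ (H x) * σ (H y) * (σ (adj G x z) * σ (adj G z y)))
      ≡⟨ ∑-scale (σ (H x) * σ (H y)) (λ z → σ (adj G x z) * σ (adj G z y)) ⟩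
    σ (H x) * σ (H y) * signedWalks G x y
      ∎
    where
    regroup : ∀ p q r s t → p * r * s * (r * q * t) ≡ p * q * (s * t) * (r * r)
    regroup = solve-∀
    pointwise : ∀ z → σ (adj G′ x z) * σ (adj G′ z y) ≡ σ (H x) * σ (H y) * (σ (adj G x z) * σ (adj G z y))
    pointwise z = begin
      σ (adj G′ x z) * σ (adj G′ z y)
        ≡⟨ cong₂ _*_ (switched-sign x z) (switched-sign z y) ⟩
      σ (H x) * σ (H z) * σ (adj G x z) * (σ (H z) * σ (H y) * σ (adj G z y))
        ≡⟨ regroup (σ (H x)) (σ (H y)) (σ (H z)) (σ (adj G x z)) (σ (adj G z y)) ⟩
      σ (H x) * σ (H y) * (σ (adj G x z) * σ (adj G z y)) * (σ (H z) * σ (H z))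
        ≡⟨ cong (_*_ (σ (H x) * σ (H y) * (σ (adj G x z) * σ (adj G z y)))) (σ-square (H z)) ⟩
      σ (H x) * σ (H y) * (σ (adj G x z) * σ (adj G z y)) * 1ℤ
        ≡⟨ *-identityʳ _ ⟩
      σ (H x) * σ (H y) * (σ (adj G x z) * σ (adj G z y))
        ∎

  switching-preserves-walks : ∀ {lam mu} → WalkCondition G lam mu → WalkCondition G′ lam mu
  switching-preserves-walks {lam} {mu} walks x y x≢y = begin
    signedWalks G′ x y                                            ≡⟨ switched-walks x y ⟩
    σ (H x) * σ (H y) * signedWalks G x y                         ≡⟨ cong (_*_ (σ (H x) * σ (H y))) (walks x y x≢y) ⟩
    σ (H x) * σ (H y) * (+ 2 * (+ mu - + lam) * σ (adj G x y))    ≡⟨ commute (σ (H x) * σ (H y)) (+ 2 * (+ mu - + lam)) (σ (adj G x y)) ⟩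
    + 2 * (+ mu - + lam) * (σ (H x) * σ (H y) * σ (adj G x y))    ≡⟨ cong (_*_ (+ 2 * (+ mu - + lam))) (sym (switched-sign x y)) ⟩
    + 2 * (+ mu - + lam) * σ (adj G′ x y)                         ∎
    where
    commute : ∀ s c t → s * (c * t) ≡ c * (s * t)
    commute = solve-∀

theorem1p1 : (v k lam mu : ℕ) (G : Graph v) (θ₁ θ₂ : ℤ) (H : Fin v → Bool) →
    IsSRG G k lam mu → Primitive G →
    IsEigenvalue G θ₁ → IsEigenvalue G θ₂ → θ₂ < θ₁ → θ₁ < + k →
    + v ≡ + 2 * (+ k - θ₁) →
    (IsSRG (switch G H) k lam mu ⇔
    (∀ x → H x ≡ true → + 2 * + inducedDegree G H x ≡ + 2 * + k - (+ v - + count H)))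
theorem1p1 v k lam mu G θ₁ _ H srg _ eigen₁ _ _ θ₁<k v≡2[k-θ₁] = mk⇔ switched⇒balanced balanced⇒switched
  where
  open Adjacency G
  open StronglyRegular k lam mu srg
  open Switching G H

  θ₁≢k : θ₁ ≢ K
  θ₁≢k = <⇒≢ θ₁<k

  θ₁-root : Root θ₁
  θ₁-root = eigenvalue-root θ₁ eigen₁ θ₁≢k

  relation : V ≡ + 4 * K - + 2 * L - + 2 * M
  relation = half-gap-parameters {V} {K} {L} {M} {θ₁} θ₁≢k θ₁-root (vertex-count (eigenvector-vertex G θ₁ eigen₁)) v≡2[k-θ₁]

  -- (i) ⇒ (ii): both graphs are k-regular, so every vertex of H is balanced.
  switched⇒balanced : IsSRG G′ k lam mu → ∀ x → H x ≡ true → + 2 * + inducedDegree G H x ≡ + 2 * K - (V - h)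
  switched⇒balanced srg′ x x∈H = begin
    + 2 * + inducedDegree G H x    ≡⟨ Equivalence.to (degree-preserved x) (trans (proj₁ srg′ x) (sym (proj₁ srg x))) ⟩
    balance (H x) (+ degree G x)   ≡⟨ cong₂ balance x∈H (cong (λ d → + d) (proj₁ srg x)) ⟩
    + 2 * K - (V - h)              ∎

  -- (ii) ⇒ (i): balance propagates off H, so G′ is k-regular; switching preserves the walk condition.
  balanced⇒switched : (∀ x → H x ≡ true → + 2 * + inducedDegree G H x ≡ + 2 * K - (V - h)) → IsSRG G′ k lam mu
  balanced⇒switched balanced-on-H =
    walks⇒srg G′ {k} {lam} {mu} regular′ relation
      (switching-preserves-walks {lam} {mu} (srg⇒walks G {k} {lam} {mu} srg relation))
    where
    inside : ∀ x → H x ≡ true → + 2 * + inducedDegree G H x ≡ balance true (+ degree G x)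
    inside x x∈H = trans (balanced-on-H x x∈H) (cong (λ d → + 2 * + d - (V - h)) (sym (proj₁ srg x)))
    outside : ∀ x → H x ≡ false → + 2 * + inducedDegree G H x ≡ h
    outside = balance-propagates θ₁ θ₁-root v≡2[k-θ₁] H balanced-on-H
    regular′ : ∀ x → degree G′ x ≡ k
    regular′ x = trans (Equivalence.from (degree-preserved x) (balanced-everywhere inside outside x)) (proj₁ srg x)
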